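{- Let $\lambda > 1$ be real and $k$ a natural number. Then $A_\lambda(k)$ is divisible by $p_{k+1} p_{k+2} \cdots p_{u_\lambda(k)}$.
   Context: $p_i$ denotes the $i$-th prime ($p_1 = 2, p_2 = 3, \ldots$). For a natural number $n$, $\sigma_{ -1}(n) = \sigma(n)/n$, where $\sigma(n)$ is the sum of the positive divisors of $n$. For $\lambda > 1$ and natural $k$, $u_\lambda(k) = \min\{ s : \prod_{j=k+1}^{s} \frac{p_j}{p_j - 1} \geq \lambda \}$, and $A_\lambda(k)$ is the smallest natural number such that $\sigma_{ -1}(A_\lambda(k)) \geq \lambda$ and $A_\lambda(k)$ is divisible by none of $p_1, \ldots, p_k$. -}

module Defs where

open import Data.Nat as ℕ using (ℕ; zero; suc; _∸_)
open import Data.Nat.Divisibility using (_∣_; _∣?_)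
open import Data.Nat.Primality using (Prime; prime?)
open import Data.List using (List; filter; upTo; map; length; foldr)
open import Data.Nat.ListAction using (sum)
open import Data.Integer using (+_)
open import Data.Rational using (ℚ; _/_; 1ℚ; 0ℚ; _*_; _≤_; _<_)
open import Data.Product using (∃; _×_)
open import Relation.Nullary using (¬_)
open import Relation.Binary.PropositionalEquality using (_≡_)

primesBelow : ℕ → ℕ
primesBelow q = length (filter prime? (upTo q))

-- p enumerates the primes, 1-indexed: p (suc i) is the (i+1)-th prime,
-- i.e. a prime with exactly i primes below it.  (p 0 is irrelevant.)
IsPrimeEnumeration : (ℕ → ℕ) → Set
IsPrimeEnumeration p = ∀ i → Prime (p (suc i)) × primesBelow (p (suc i)) ≡ i

σ : ℕ → ℕ
σ n = sum (filter (_∣? n) (upTo (suc n)))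

-- σ₋₁(n) = σ(n)/n for n ≥ 1 (value at 0 is an irrelevant convention).
σ₋₁ : ℕ → ℚ
σ₋₁ zero = 0ℚ
σ₋₁ (suc m) = + σ (suc m) / suc m

-- q/(q-1) for q ≥ 2 (written with denominator suc (q ∸ 2) = q - 1 when q ≥ 2).
ratio : ℕ → ℚ
ratio q = + q / suc (q ∸ 2)

range : ℕ → ℕ → List ℕ
range a b = map (λ i → a ℕ.+ i) (upTo (suc b ∸ a))

prodRatio : (ℕ → ℕ) → ℕ → ℕ → ℚ
prodRatio p k s = foldr (λ j acc → ratio (p j) * acc) 1ℚ (range (suc k) s)

prodPrimes : (ℕ → ℕ) → ℕ → ℕ → ℕ
prodPrimes p k s = foldr (λ j acc → p j ℕ.* acc) 1 (range (suc k) s)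

-- A real number λ > 1 is represented by the set  Geq = { q ∈ ℚ : q ≥ λ }.
-- Classically these conditions characterise exactly such sets for real λ > 1.
record RealAboveOne (Geq : ℚ → Set) : Set₁ where
  field
    upward    : ∀ {q r} → q ≤ r → Geq q → Geq r
    closed    : ∀ q → (∀ r → q < r → Geq r) → Geq q
    inhabited : ∃ Geq
    notOne    : ¬ Geq 1ℚ

IsU : (ℚ → Set) → (ℕ → ℕ) → ℕ → ℕ → Set
IsU Geq p k s = Geq (prodRatio p k s) × (∀ t → t ℕ.< s → ¬ Geq (prodRatio p k t))

Admissible : (ℚ → Set) → (ℕ → ℕ) → ℕ → ℕ → Set
Admissible Geq p k n =
  1 ℕ.≤ n × Geq (σ₋₁ n) × (∀ j → 1 ℕ.≤ j → j ℕ.≤ k → ¬ (p j ∣ n))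

IsA : (ℚ → Set) → (ℕ → ℕ) → ℕ → ℕ → Set
IsA Geq p k A = Admissible Geq p k A × (∀ m → m ℕ.< A → ¬ Admissible Geq p k m)

{-# OPTIONS --safe #-}
-- Fix k < j ≤ u and suppose p_j ∤ A.  If A has a prime factor r > p_u, with r^a ∥ A,
-- then exchanging r^a for p_j^a gives a smaller number, still free of p_1, …, p_k,
-- whose σ₋₁ is at least σ₋₁(A), because σ₋₁(q^a) = (1 + q + ⋯ + q^a)/q^a decreases in q;
-- this contradicts the minimality of A.  Otherwise every prime factor of A is one of
-- p_{k+1}, …, p_u other than p_j, so σ₋₁(A) ≤ ∏ q/(q−1) over these primes, and
-- trading p_u for p_j (which has the larger ratio) bounds this by ∏_{i=k+1}^{u−1}
-- p_i/(p_i−1); this contradicts the minimality of u.  Hence every p_j divides A, and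
-- being distinct primes, so does their product.
module Submission where

open import Defs
open import Data.Nat as ℕ
  using (ℕ; zero; suc; pred; NonZero; z<s; _+_; _*_; _^_; _∸_; _≤_; _<_; s≤s; z≤n; _≟_; >-nonZero)
open import Data.Nat.Properties
open import Data.Nat.Divisibility
open import Data.Nat.Primality
open import Data.Nat.Primality.Factorisation using (factorise; factorisationHasAllPrimeFactors)
open import Data.Nat.Coprimality as Coprimality using (Coprime; coprime-divisor; coprime⇒gcd≡1)
open import Data.Nat.LCM using (lcm; gcd*lcm; lcm-least)
open import Data.Nat.Induction using (<-wellFounded)
open import Data.Nat.ListAction using (sum; product)
open import Data.Nat.ListAction.Properties using (sum-++; sum-↭)
open import Data.Nat.Solver using (module +-*-Solver)
open import Algebra.Properties.CommutativeSemigroup *-commutativeSemigroup using (interchange)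
open import Data.Integer as ℤ using (+_)
import Data.Integer.Properties as ℤ
open import Data.Rational as ℚ using (ℚ; 1ℚ; _/_)
import Data.Rational.Properties as ℚ
open import Data.Rational.Unnormalised using (mkℚᵘ; *≤*; *≡*)
import Data.Rational.Unnormalised.Properties as ℚᵘ
open import Data.List using (List; []; _∷_; _++_; map; filter; upTo; length; foldr)
open import Data.List.Properties using (filter-++; length-++; upTo-∷ʳ; foldr-map; map-∘)
open import Data.List.Membership.Propositional using (_∈_)
open import Data.List.Membership.Propositional.Properties
open import Data.List.Membership.Propositional.Properties.WithK using (unique∧set⇒bag)
open import Data.List.Relation.Binary.BagAndSetEquality using (∼bag⇒↭)
open import Data.List.Relation.Unary.All as All using (All; []; _∷_)
import Data.List.Relation.Unary.All.Properties as All
open import Data.List.Relation.Unary.Any using (here; there)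
open import Data.List.Relation.Unary.Unique.Propositional using (Unique; []; _∷_)
import Data.List.Relation.Unary.Unique.Propositional.Properties as Unique
open import Data.Product using (∃; ∃₂; _×_; _,_; proj₁; proj₂; uncurry)
open import Data.Sum using (inj₁; inj₂)
open import Data.Empty using (⊥)
open import Function using (_∘_)
open import Function.Bundles using (mk⇔)
open import Induction.WellFounded using (Acc; acc)
open import Relation.Nullary using (¬_; yes; no; contradiction)
open import Relation.Nullary.Decidable using (decidable-stable)
open import Relation.Binary using (tri<; tri≈; tri>)
open import Relation.Binary.PropositionalEquality

open +-*-Solver

-- Both sides are compared as unnormalised fractions: + a / suc b is fromℚᵘ (mkℚᵘ (+ a) b).
fraction-≤ : ∀ a b c d .{{_ : NonZero b}} .{{_ : NonZero d}} →
             a * d ≤ c * b → + a / b ℚ.≤ + c / d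
fraction-≤ a (suc b) c (suc d) ad≤cb = ℚ.toℚᵘ-cancel-≤
  (ℚᵘ.≤-respʳ-≃ (ℚᵘ.≃-sym (ℚ.toℚᵘ-fromℚᵘ (mkℚᵘ (+ c) d)))
  (ℚᵘ.≤-respˡ-≃ (ℚᵘ.≃-sym (ℚ.toℚᵘ-fromℚᵘ (mkℚᵘ (+ a) b)))
    (*≤* (subst₂ ℤ._≤_ (ℤ.pos-* a (suc d)) (ℤ.pos-* c (suc b)) (ℤ.+≤+ ad≤cb)))))

fraction-* : ∀ a b c d .{{_ : NonZero b}} .{{_ : NonZero d}} →
             (+ a / b) ℚ.* (+ c / d) ≡ (+ (a * c) / (b * d)) {{m*n≢0 b d}}
fraction-* a (suc b) c (suc d) = ℚ.toℚᵘ-injective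
  (ℚᵘ.≃-trans (ℚ.toℚᵘ-homo-* (+ a / suc b) (+ c / suc d))
  (ℚᵘ.≃-trans (ℚᵘ.*-cong (ℚ.toℚᵘ-fromℚᵘ (mkℚᵘ (+ a) b)) (ℚ.toℚᵘ-fromℚᵘ (mkℚᵘ (+ c) d)))
  (ℚᵘ.≃-trans (*≡* (cong (ℤ._* + (suc b * suc d)) (sym (ℤ.pos-* a c))))
    (ℚᵘ.≃-sym (ℚ.toℚᵘ-fromℚᵘ (mkℚᵘ (+ (a * c)) (d + b * suc d)))))))

σ₋₁-≤-fraction : ∀ n c d .{{_ : NonZero d}} → 0 < n → σ n * d ≤ c * n → σ₋₁ n ℚ.≤ + c / d
σ₋₁-≤-fraction (suc n) c d _ = fraction-≤ (σ (suc n)) (suc n) c d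

σ₋₁-≤ : ∀ m n → 0 < m → 0 < n → σ m * n ≤ σ n * m → σ₋₁ m ℚ.≤ σ₋₁ n
σ₋₁-≤ m (suc n) m>0 _ = σ₋₁-≤-fraction m (σ (suc n)) (suc n) m>0

<∸⇒+< : ∀ a i n → i < n ∸ a → a + i < n
<∸⇒+< zero    i n       i<n = i<n
<∸⇒+< (suc a) i (suc n) i<n = s≤s (<∸⇒+< a i n i<n)

∈-range⁻ : ∀ {a b j} → j ∈ range a b → a ≤ j × j ≤ b
∈-range⁻ {a} {b} j∈ with ∈-map⁻ (λ i → a + i) j∈
... | i , i∈ , refl = m≤m+n a i , ≤-pred (<∸⇒+< a i (suc b) (∈-upTo⁻ i∈))

∈-range⁺ : ∀ {a b j} → a ≤ j → j ≤ b → j ∈ range a b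
∈-range⁺ {a} {b} {j} a≤j j≤b = subst (_∈ range a b) (m+[n∸m]≡n a≤j)
  (∈-map⁺ (λ i → a + i) (∈-upTo⁺ (subst (j ∸ a <_) (sym (+-∸-assoc 1 (≤-trans a≤j j≤b)))
    (s≤s (∸-monoˡ-≤ a j≤b)))))

prime>1 : ∀ {q} → Prime q → 1 < q
prime>1 {q} q-prime = ℕ.nonTrivial⇒n>1 q {{prime⇒nonTrivial q-prime}}

prime∤⇒coprime : ∀ {q n} → Prime q → ¬ q ∣ n → Coprime n q
prime∤⇒coprime q-prime q∤n (d∣n , d∣q) with prime⇒irreducible q-prime d∣q
... | inj₁ d≡1 = d≡1
... | inj₂ refl = contradiction d∣n q∤n

prime-∣-prime : ∀ {q r} → Prime q → Prime r → q ∣ r → q ≡ r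
prime-∣-prime q-prime r-prime q∣r with prime⇒irreducible r-prime q∣r
... | inj₁ refl = contradiction q-prime ¬prime[1]
... | inj₂ q≡r = q≡r

prime-∣-^ : ∀ {q s} a → Prime q → q ∣ s ^ a → q ∣ s
prime-∣-^ zero q-prime q∣1 = contradiction q-prime (subst (¬_ ∘ Prime) (sym (∣1⇒≡1 q∣1)) ¬prime[1])
prime-∣-^ {s = s} (suc a) q-prime q∣s^1+a with euclidsLemma s (s ^ a) q-prime q∣s^1+a
... | inj₁ q∣s = q∣s
... | inj₂ q∣s^a = prime-∣-^ a q-prime q∣s^a

∃-prime-∣ : ∀ n → 1 < n → ∃ λ r → Prime r × r ∣ n
∃-prime-∣ (suc zero) (s≤s ())
∃-prime-∣ n@(suc (suc _)) _ with factorise n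
... | record { factors = r ∷ rs ; isFactorisation = n≡Πr∷rs ; factorsPrime = r-prime ∷ _ } =
  r , r-prime , subst (r ∣_) (sym n≡Πr∷rs) (m∣m*n (product rs))

coprime-∣-* : ∀ {m n c} → Coprime m n → m ∣ c → n ∣ c → m * n ∣ c
coprime-∣-* {m} {n} m⊥n m∣c n∣c = subst (_∣ _) lcm≡m*n (lcm-least m∣c n∣c)
  where
  lcm≡m*n : lcm m n ≡ m * n
  lcm≡m*n = trans (sym (*-identityˡ (lcm m n)))
    (trans (cong (_* lcm m n) (sym (coprime⇒gcd≡1 m⊥n))) (gcd*lcm m n))

product-∣ : ∀ {qs n} → All Prime qs → Unique qs → All (_∣ n) qs → product qs ∣ n
product-∣ {[]} {n} [] [] [] = 1∣ n
product-∣ {q ∷ qs} (q-prime ∷ qs-prime) (q∉qs ∷ qs-unique) (q∣n ∷ qs∣n) =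
  coprime-∣-* (Coprimality.sym (prime∤⇒coprime q-prime q∤Πqs)) q∣n (product-∣ qs-prime qs-unique qs∣n)
  where
  q∤Πqs : ¬ q ∣ product qs
  q∤Πqs = λ q∣Πqs → All.lookup q∉qs (factorisationHasAllPrimeFactors q-prime q∣Πqs qs-prime) refl

prime-power-split : ∀ {q} → Prime q → ∀ n → 0 < n →
                    ∃₂ λ a m → n ≡ q ^ a * m × ¬ q ∣ m × 0 < m
prime-power-split {q} q-prime n = split n (<-wellFounded n)
  where
  split : ∀ n → Acc _<_ n → 0 < n → ∃₂ λ a m → n ≡ q ^ a * m × ¬ q ∣ m × 0 < m
  split n _ n>0 with q ∣? n
  ... | no q∤n = 0 , n , sym (*-identityˡ n) , q∤n , n>0
  split _ (acc rec) _ | yes (divides c@(suc _) refl)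
    with a , m , c≡q^a*m , q∤m , m>0 ← split c (rec (m<m*n c q (prime>1 q-prime))) z<s =
    suc a , m , trans (cong (_* q) c≡q^a*m) (rotate (q ^ a) m q) , q∤m , m>0
    where
    rotate : ∀ x y z → x * y * z ≡ z * x * y
    rotate = solve 3 (λ x y z → x :* y :* z := z :* x :* y) refl

divisors : ℕ → List ℕ
divisors n = filter (_∣? n) (upTo (suc n))

divisors-unique : ∀ n → Unique (divisors n)
divisors-unique n = Unique.filter⁺ (_∣? n) (Unique.upTo⁺ (suc n))

∈-divisors⁺ : ∀ {d n} .{{_ : NonZero n}} → d ∣ n → d ∈ divisors n
∈-divisors⁺ d∣n = ∈-filter⁺ (_∣? _) (∈-upTo⁺ (s≤s (∣⇒≤ d∣n))) d∣n

∈-divisors⁻ : ∀ {d n} → d ∈ divisors n → d ∣ n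
∈-divisors⁻ {n = n} d∈ = proj₂ (∈-filter⁻ (_∣? n) {xs = upTo (suc n)} d∈)

sum-map-* : ∀ c ns → sum (map (c *_) ns) ≡ c * sum ns
sum-map-* c []       = sym (*-zeroʳ c)
sum-map-* c (n ∷ ns) = trans (cong (λ s → c * n + s) (sum-map-* c ns)) (sym (*-distribˡ-+ c n (sum ns)))

coprime-∣-^-* : ∀ {d q m} a → Coprime d q → d ∣ q ^ a * m → d ∣ m
coprime-∣-^-* {d} {q} {m} zero    _   d∣m = subst (d ∣_) (*-identityˡ m) d∣m
coprime-∣-^-* {d} {q} {m} (suc a) d⊥q d∣qq^a*m =
  coprime-∣-^-* a d⊥q (coprime-divisor d⊥q (subst (d ∣_) (*-assoc q (q ^ a) m) d∣qq^a*m))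

geometricSum : ℕ → ℕ → ℕ
geometricSum q zero    = 1
geometricSum q (suc a) = 1 + q * geometricSum q a

module PrimePowerTimes {q m : ℕ} (q-prime : Prime q) (q∤m : ¬ q ∣ m) .{{_ : NonZero m}} where

  instance
    q≢0 : NonZero q
    q≢0 = prime⇒nonZero q-prime

  divisorList : ℕ → List ℕ
  divisorList zero    = divisors m
  divisorList (suc a) = divisors m ++ map (q *_) (divisorList a)

  ∈-divisorList⁻ : ∀ a {d} → d ∈ divisorList a → d ∣ q ^ a * m
  ∈-divisorList⁻ zero {d} d∈ = subst (d ∣_) (sym (*-identityˡ m)) (∈-divisors⁻ d∈)
  ∈-divisorList⁻ (suc a) d∈ with ∈-++⁻ (divisors m) d∈
  ... | inj₁ d∈D = ∣-trans (∈-divisors⁻ d∈D) (n∣m*n (q ^ suc a))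
  ... | inj₂ d∈qD with e , e∈ , refl ← ∈-map⁻ (q *_) d∈qD =
    subst (q * e ∣_) (sym (*-assoc q (q ^ a) m)) (*-monoʳ-∣ q (∈-divisorList⁻ a e∈))

  ∈-divisorList⁺ : ∀ a {d} → d ∣ q ^ a * m → d ∈ divisorList a
  ∈-divisorList⁺ zero {d} d∣m = ∈-divisors⁺ (subst (d ∣_) (*-identityˡ m) d∣m)
  ∈-divisorList⁺ (suc a) {d} d∣ with q ∣? d
  ... | no q∤d = ∈-++⁺ˡ (∈-divisors⁺ (coprime-∣-^-* (suc a) (prime∤⇒coprime q-prime q∤d) d∣))
  ... | yes (divides e refl) = ∈-++⁺ʳ (divisors m) (subst (_∈ map (q *_) (divisorList a)) (*-comm q e)
        (∈-map⁺ (q *_) (∈-divisorList⁺ a (*-cancelˡ-∣ q (subst₂ _∣_ (*-comm e q) (*-assoc q (q ^ a) m) d∣)))))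

  divisorList-unique : ∀ a → Unique (divisorList a)
  divisorList-unique zero    = divisors-unique m
  divisorList-unique (suc a) = Unique.++⁺ (divisors-unique m)
    (Unique.map⁺ (*-cancelˡ-≡ _ _ q) (divisorList-unique a)) disjoint
    where
    disjoint : ∀ {d} → ¬ (d ∈ divisors m × d ∈ map (q *_) (divisorList a))
    disjoint (d∈D , d∈qD) with e , _ , refl ← ∈-map⁻ (q *_) d∈qD =
      q∤m (∣-trans (m∣m*n e) (∈-divisors⁻ d∈D))

  sum-divisorList : ∀ a → sum (divisorList a) ≡ geometricSum q a * σ m
  sum-divisorList zero    = sym (+-identityʳ (σ m))
  sum-divisorList (suc a) = begin
    sum (divisors m ++ map (q *_) (divisorList a)) ≡⟨ sum-++ (divisors m) _ ⟩
    σ m + sum (map (q *_) (divisorList a))         ≡⟨ cong (λ s → σ m + s) (sum-map-* q (divisorList a)) ⟩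
    σ m + q * sum (divisorList a)                  ≡⟨ cong (λ s → σ m + q * s) (sum-divisorList a) ⟩
    σ m + q * (geometricSum q a * σ m)             ≡⟨ solve 3 (λ s q g → s :+ q :* (g :* s) := (con 1 :+ q :* g) :* s)
                                                             refl (σ m) q (geometricSum q a) ⟩
    geometricSum q (suc a) * σ m                   ∎
    where open ≡-Reasoning

  σ-^-* : ∀ a → σ (q ^ a * m) ≡ geometricSum q a * σ m
  σ-^-* a = trans (sum-↭ (∼bag⇒↭ (unique∧set⇒bag (divisors-unique (q ^ a * m)) (divisorList-unique a)
              (mk⇔ (∈-divisorList⁺ a ∘ ∈-divisors⁻) (∈-divisors⁺ {{q^a*m≢0}} ∘ ∈-divisorList⁻ a)))))
            (sum-divisorList a)
    where
    q^a*m≢0 : NonZero (q ^ a * m)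
    q^a*m≢0 = m*n≢0 (q ^ a) m {{m^n≢0 q a}}

open PrimePowerTimes using (σ-^-*)

geometricSum-*-pred : ∀ r a → geometricSum (suc r) a * r + 1 ≡ suc r ^ suc a
geometricSum-*-pred r zero    = solve 1 (λ r → con 1 :* r :+ con 1 := (con 1 :+ r) :* con 1) refl r
geometricSum-*-pred r (suc a) = begin
  (1 + suc r * geometricSum (suc r) a) * r + 1 ≡⟨ solve 2 (λ r g → (con 1 :+ (con 1 :+ r) :* g) :* r :+ con 1
                                                         := (con 1 :+ r) :* (g :* r :+ con 1))
                                                     refl r (geometricSum (suc r) a) ⟩
  suc r * (geometricSum (suc r) a * r + 1)     ≡⟨ cong (suc r *_) (geometricSum-*-pred r a) ⟩
  suc r * suc r ^ suc a                        ∎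
  where open ≡-Reasoning

geometricSum-antitone : ∀ {x y} a → y ≤ x → geometricSum x a * y ^ a ≤ geometricSum y a * x ^ a
geometricSum-antitone zero _ = ≤-refl
geometricSum-antitone {x} {y} (suc a) y≤x = begin
  geometricSum x (suc a) * y ^ suc a                ≡⟨ unfold x y (geometricSum x a) (y ^ a) ⟩
  y * y ^ a + x * y * (geometricSum x a * y ^ a)
    ≤⟨ +-mono-≤ (^-monoˡ-≤ (suc a) y≤x) (*-monoʳ-≤ (x * y) (geometricSum-antitone a y≤x)) ⟩
  x * x ^ a + x * y * (geometricSum y a * x ^ a)    ≡⟨ cong (λ z → x * x ^ a + z * (geometricSum y a * x ^ a)) (*-comm x y) ⟩
  x * x ^ a + y * x * (geometricSum y a * x ^ a)    ≡⟨ unfold y x (geometricSum y a) (x ^ a) ⟨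
  geometricSum y (suc a) * x ^ suc a                ∎
  where
  open ≤-Reasoning
  unfold : ∀ x y g t → (1 + x * g) * (y * t) ≡ y * t + x * y * (g * t)
  unfold = solve 4 (λ x y g t → (con 1 :+ x :* g) :* (y :* t) := y :* t :+ x :* y :* (g :* t)) refl

-- For q ≥ 2 this is q − 1, the denominator of ratio q.
ratio-den : ℕ → ℕ
ratio-den q = suc (q ∸ 2)

geometricSum-*-ratio-den : ∀ {q} → 1 < q → ∀ a → geometricSum q a * ratio-den q ≤ q * q ^ a
geometricSum-*-ratio-den {suc zero} (s≤s ()) _
geometricSum-*-ratio-den {suc (suc r)} _ a = ≤-trans (m≤m+n _ 1) (≤-reflexive (geometricSum-*-pred (suc r) a))

ratio-antitone : ∀ {x y} → 1 < x → x ≤ y → y * ratio-den x ≤ x * ratio-den y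
ratio-antitone {suc zero} (s≤s ()) _
ratio-antitone {suc (suc a)} _ x≤y with c , refl ← m≤n⇒∃[o]m+o≡n x≤y =
  ≤-trans (m≤m+n _ c) (≤-reflexive (sym (expand a c)))
  where
  expand : ∀ a c → (2 + a) * suc (a + c) ≡ (2 + a + c) * suc a + c
  expand = solve 2 (λ a c → (con 2 :+ a) :* (con 1 :+ (a :+ c)) := (con 2 :+ a :+ c) :* (con 1 :+ a) :+ c) refl

σ-exchange-prime-power : ∀ {r s m} a → Prime r → Prime s → s ≤ r → ¬ r ∣ m → ¬ s ∣ m → .{{_ : NonZero m}} →
                         σ (r ^ a * m) * (s ^ a * m) ≤ σ (s ^ a * m) * (r ^ a * m)
σ-exchange-prime-power {r} {s} {m} a r-prime s-prime s≤r r∤m s∤m = begin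
  σ (r ^ a * m) * (s ^ a * m)                   ≡⟨ cong (_* (s ^ a * m)) (σ-^-* r-prime r∤m a) ⟩
  geometricSum r a * σ m * (s ^ a * m)          ≡⟨ interchange (geometricSum r a) (σ m) (s ^ a) m ⟩
  geometricSum r a * s ^ a * (σ m * m)          ≤⟨ *-monoˡ-≤ (σ m * m) (geometricSum-antitone a s≤r) ⟩
  geometricSum s a * r ^ a * (σ m * m)          ≡⟨ interchange (geometricSum s a) (σ m) (r ^ a) m ⟨
  geometricSum s a * σ m * (r ^ a * m)          ≡⟨ cong (_* (r ^ a * m)) (σ-^-* s-prime s∤m a) ⟨
  σ (s ^ a * m) * (r ^ a * m)                   ∎
  where
  open ≤-Reasoning

σ-bound : ∀ {qs} → All Prime qs → ∀ n → 0 < n → (∀ r → Prime r → r ∣ n → r ∈ qs) →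
          σ n * product (map ratio-den qs) ≤ n * product qs
σ-bound [] (suc zero) _ _ = ≤-refl
σ-bound [] n@(suc (suc _)) _ factors∈[] with r , r-prime , r∣n ← ∃-prime-∣ n (s≤s (s≤s z≤n))
  with () ← factors∈[] r r-prime r∣n
σ-bound {q ∷ qs} (q-prime ∷ qs-prime) n n>0 factors∈q∷qs
  with a , m , refl , q∤m , m>0 ← prime-power-split q-prime n n>0 = begin
  σ (q ^ a * m) * (ratio-den q * product (map ratio-den qs))
    ≡⟨ cong (_* _) (σ-^-* q-prime q∤m {{>-nonZero m>0}} a) ⟩
  geometricSum q a * σ m * (ratio-den q * product (map ratio-den qs))
    ≡⟨ interchange (geometricSum q a) (σ m) (ratio-den q) _ ⟩
  geometricSum q a * ratio-den q * (σ m * product (map ratio-den qs))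
    ≤⟨ *-mono-≤ (geometricSum-*-ratio-den (prime>1 q-prime) a) (σ-bound qs-prime m m>0 factors∈qs) ⟩
  q * q ^ a * (m * product qs)
    ≡⟨ solve 4 (λ q t m p → q :* t :* (m :* p) := t :* m :* (q :* p)) refl q (q ^ a) m (product qs) ⟩
  q ^ a * m * (q * product qs) ∎
  where
  open ≤-Reasoning
  factors∈qs : ∀ r → Prime r → r ∣ m → r ∈ qs
  factors∈qs r r-prime r∣m with factors∈q∷qs r r-prime (∣-trans r∣m (n∣m*n (q ^ a)))
  ... | here refl = contradiction r∣m q∤m
  ... | there r∈qs = r∈qs

product-ratio-den≢0 : ∀ qs → NonZero (product (map ratio-den qs))
product-ratio-den≢0 []       = _
product-ratio-den≢0 (q ∷ qs) = m*n≢0 (ratio-den q) (product (map ratio-den qs)) {{_}} {{product-ratio-den≢0 qs}}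

ratioProduct : (ℕ → ℕ) → List ℕ → ℚ
ratioProduct f = foldr (λ i acc → ratio (f i) ℚ.* acc) 1ℚ

ratioProduct≡fraction : ∀ f is → ratioProduct f is ≡ (+ product (map f is) / product (map ratio-den (map f is)))
                                  {{product-ratio-den≢0 (map f is)}}
ratioProduct≡fraction f []       = refl
ratioProduct≡fraction f (i ∷ is) = trans (cong (ratio (f i) ℚ.*_) (ratioProduct≡fraction f is))
  (fraction-* (f i) (ratio-den (f i)) (product (map f is)) (product (map ratio-den (map f is)))
    {{_}} {{product-ratio-den≢0 (map f is)}})

ratioProduct-mono : ∀ f g is → (∀ i → i ∈ is → f i * ratio-den (g i) ≤ g i * ratio-den (f i)) →
                    ratioProduct f is ℚ.≤ ratioProduct g is
ratioProduct-mono f g is f≤g = subst₂ ℚ._≤_ (sym (ratioProduct≡fraction f is)) (sym (ratioProduct≡fraction g is))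
  (fraction-≤ (product (map f is)) (product (map ratio-den (map f is)))
               (product (map g is)) (product (map ratio-den (map g is)))
               {{product-ratio-den≢0 (map f is)}} {{product-ratio-den≢0 (map g is)}} (cross is f≤g))
  where
  cross : ∀ is → (∀ i → i ∈ is → f i * ratio-den (g i) ≤ g i * ratio-den (f i)) →
          product (map f is) * product (map ratio-den (map g is)) ≤
          product (map g is) * product (map ratio-den (map f is))
  cross []       _   = ≤-refl
  cross (i ∷ is) f≤g = begin
    f i * F * (ratio-den (g i) * G′)           ≡⟨ interchange (f i) F (ratio-den (g i)) G′ ⟩
    f i * ratio-den (g i) * (F * G′)           ≤⟨ *-mono-≤ (f≤g i (here refl)) (cross is (λ j → f≤g j ∘ there)) ⟩
    g i * ratio-den (f i) * (G * F′)           ≡⟨ interchange (g i) G (ratio-den (f i)) F′ ⟨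
    g i * G * (ratio-den (f i) * F′)           ∎
    where
    open ≤-Reasoning
    F = product (map f is)
    G = product (map g is)
    F′ = product (map ratio-den (map f is))
    G′ = product (map ratio-den (map g is))

σ₋₁-≤-ratioProduct : ∀ f is → (∀ i → i ∈ is → Prime (f i)) → ∀ n → 0 < n →
                     (∀ r → Prime r → r ∣ n → r ∈ map f is) → σ₋₁ n ℚ.≤ ratioProduct f is
σ₋₁-≤-ratioProduct f is f-prime n n>0 factors∈ = subst (σ₋₁ n ℚ.≤_) (sym (ratioProduct≡fraction f is))
  (σ₋₁-≤-fraction n (product (map f is)) (product (map ratio-den (map f is)))
    {{product-ratio-den≢0 (map f is)}} n>0
    (≤-trans (σ-bound (All.map⁺ (All.tabulate (f-prime _))) n n>0 factors∈) (≤-reflexive (*-comm n _))))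

primesBelow-suc : ∀ q → primesBelow (suc q) ≡ primesBelow q + length (filter prime? (q ∷ []))
primesBelow-suc q = begin
  length (filter prime? (upTo (suc q)))                     ≡⟨ cong (length ∘ filter prime?) (upTo-∷ʳ q) ⟨
  length (filter prime? (upTo q ++ q ∷ []))                 ≡⟨ cong length (filter-++ prime? (upTo q) (q ∷ [])) ⟩
  length (filter prime? (upTo q) ++ filter prime? (q ∷ [])) ≡⟨ length-++ (filter prime? (upTo q)) ⟩
  primesBelow q + length (filter prime? (q ∷ []))           ∎
  where open ≡-Reasoning

primesBelow-≤-+ : ∀ m o → primesBelow m ≤ primesBelow (m + o)
primesBelow-≤-+ m zero    = ≤-reflexive (cong primesBelow (sym (+-identityʳ m)))
primesBelow-≤-+ m (suc o) = begin
  primesBelow m                                           ≤⟨ primesBelow-≤-+ m o ⟩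
  primesBelow (m + o)                                     ≤⟨ m≤m+n _ _ ⟩
  primesBelow (m + o) + length (filter prime? (m + o ∷ [])) ≡⟨ primesBelow-suc (m + o) ⟨
  primesBelow (suc (m + o))                               ≡⟨ cong primesBelow (+-suc m o) ⟨
  primesBelow (m + suc o)                                 ∎
  where open ≤-Reasoning

primesBelow-mono : ∀ {m n} → m ≤ n → primesBelow m ≤ primesBelow n
primesBelow-mono {m} m≤n with o , refl ← m≤n⇒∃[o]m+o≡n m≤n = primesBelow-≤-+ m o

primesBelow-prime-< : ∀ {q n} → Prime q → q < n → primesBelow q < primesBelow n
primesBelow-prime-< {q} q-prime q<n with prime? q | primesBelow-suc q
... | yes _      | counted = ≤-trans (≤-reflexive (trans (+-comm 1 _) (sym counted))) (primesBelow-mono q<n)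
... | no ¬prime | _        = contradiction q-prime ¬prime

module PrimeEnumeration (p : ℕ → ℕ) (p-enum : IsPrimeEnumeration p) where

  p-prime : ∀ {i} → 0 < i → Prime (p i)
  p-prime {suc i} _ = proj₁ (p-enum i)

  primesBelow-p : ∀ i → primesBelow (p (suc i)) ≡ i
  primesBelow-p i = proj₂ (p-enum i)

  p-injective : ∀ {i j} → 0 < i → 0 < j → p i ≡ p j → i ≡ j
  p-injective {suc i} {suc j} _ _ pi≡pj =
    cong suc (trans (sym (primesBelow-p i)) (trans (cong primesBelow pi≡pj) (primesBelow-p j)))

  p-cancel-< : ∀ {i j} → 0 < i → 0 < j → p i < p j → i < j
  p-cancel-< {suc i} {suc j} _ _ pi<pj =
    s≤s (subst₂ _<_ (primesBelow-p i) (primesBelow-p j) (primesBelow-prime-< (proj₁ (p-enum i)) pi<pj))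

  p-strictMono : ∀ {i j} → 0 < i → i < j → p i < p j
  p-strictMono {i} {j} i>0 i<j with <-cmp (p i) (p j)
  ... | tri< pi<pj _ _ = pi<pj
  ... | tri≈ _ pi≡pj _ = contradiction (p-injective i>0 (<-trans i>0 i<j) pi≡pj) (<⇒≢ i<j)
  ... | tri> _ _ pi>pj = contradiction (p-cancel-< (<-trans i>0 i<j) i>0 pi>pj) (<⇒≯ i<j)

  p-mono : ∀ {i j} → 0 < i → i ≤ j → p i ≤ p j
  p-mono i>0 i≤j with m≤n⇒m<n∨m≡n i≤j
  ... | inj₁ i<j  = <⇒≤ (p-strictMono i>0 i<j)
  ... | inj₂ refl = ≤-refl

  p-surjective : ∀ {r} → Prime r → p (suc (primesBelow r)) ≡ r
  p-surjective {r} r-prime with <-cmp (p (suc (primesBelow r))) r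
  ... | tri≈ _ p≡r _ = p≡r
  ... | tri< p<r _ _ = contradiction (primesBelow-prime-< (p-prime z<s) p<r)
                                     (subst (λ n → ¬ n < primesBelow r) (sym (primesBelow-p _)) (<-irrefl refl))
  ... | tri> _ _ p>r = contradiction (primesBelow-prime-< r-prime p>r)
                                     (subst (λ n → ¬ primesBelow r < n) (sym (primesBelow-p _)) (<-irrefl refl))

  map-p-range-unique : ∀ k u → Unique (map p (range (suc k) u))
  map-p-range-unique k u = subst Unique (map-∘ (upTo (suc u ∸ suc k)))
    (Unique.map⁺ (λ {x} {y} eq → +-cancelˡ-≡ (suc k) x y (p-injective z<s z<s eq)) (Unique.upTo⁺ _))

module Minimality (p : ℕ → ℕ) (p-enum : IsPrimeEnumeration p) {Geq : ℚ → Set} (λ-real : RealAboveOne Geq)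
                  {k u A : ℕ} (u-least : IsU Geq p k u) (A-least : IsA Geq p k A) where

  open PrimeEnumeration p p-enum
  open RealAboveOne λ-real using (upward)

  A>0 : 0 < A
  A>0 = proj₁ (proj₁ A-least)

  σ₋₁A≥λ : Geq (σ₋₁ A)
  σ₋₁A≥λ = proj₁ (proj₂ (proj₁ A-least))

  A-free : ∀ i → 0 < i → i ≤ k → ¬ p i ∣ A
  A-free = proj₂ (proj₂ (proj₁ A-least))

  prime-factor-index : ∀ {r} → 0 < u → Prime r → r ∣ A → r ≤ p u → ∃ λ i → k < i × i ≤ u × p i ≡ r
  prime-factor-index {r} u>0 r-prime r∣A r≤pu = i , k<i , i≤u , pi≡r
    where
    i : ℕ
    i = suc (primesBelow r)
    pi≡r : p i ≡ r
    pi≡r = p-surjective r-prime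
    k<i : k < i
    k<i = ≰⇒> λ i≤k → A-free i z<s i≤k (subst (_∣ A) (sym pi≡r) r∣A)
    i≤u : i ≤ u
    i≤u = ≮⇒≥ λ u<i → <⇒≱ (p-strictMono u>0 u<i) (subst (_≤ p u) (sym pi≡r) r≤pu)

  module _ {j} (k<j : k < j) (j≤u : j ≤ u) (pj∤A : ¬ p j ∣ A) where

    j>0 : 0 < j
    j>0 = <-≤-trans z<s k<j

    u>0 : 0 < u
    u>0 = <-≤-trans j>0 j≤u

    pj-prime : Prime (p j)
    pj-prime = p-prime j>0

    prime-factors-≤-pu : ∀ r → Prime r → r ∣ A → r ≤ p u
    prime-factors-≤-pu r r-prime r∣A = ≮⇒≥ λ pu<r → exchange pu<r (prime-power-split r-prime A A>0)
      where
      exchange : p u < r → ∃₂ (λ a m → A ≡ r ^ a * m × ¬ r ∣ m × 0 < m) → ⊥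
      exchange _ (zero , m , refl , r∤m , _) = r∤m (subst (r ∣_) (*-identityˡ m) r∣A)
      exchange pu<r (a@(suc _) , m , refl , r∤m , m>0) =
        proj₂ A-least B B<A (B>0 , upward (σ₋₁-≤ A B A>0 B>0 σ-cross) σ₋₁A≥λ , B-free)
        where
        instance
          m≢0 : NonZero m
          m≢0 = >-nonZero m>0
          pj≢0 : NonZero (p j)
          pj≢0 = prime⇒nonZero pj-prime
        B : ℕ
        B = p j ^ a * m
        pj<r : p j < r
        pj<r = ≤-<-trans (p-mono j>0 j≤u) pu<r
        pj∤m : ¬ p j ∣ m
        pj∤m pj∣m = pj∤A (∣-trans pj∣m (n∣m*n (r ^ a)))
        B<A : B < A
        B<A = *-monoˡ-< m (^-monoˡ-< a pj<r)
        B>0 : 0 < B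
        B>0 = *-mono-≤ (m^n>0 (p j) a) m>0
        σ-cross : σ A * B ≤ σ B * A
        σ-cross = σ-exchange-prime-power a r-prime pj-prime (<⇒≤ pj<r) r∤m pj∤m
        B-free : ∀ i → 0 < i → i ≤ k → ¬ p i ∣ B
        B-free i i>0 i≤k pi∣B with euclidsLemma (p j ^ a) m (p-prime i>0) pi∣B
        ... | inj₁ pi∣pj^a = <⇒≢ (≤-<-trans i≤k k<j)
                (p-injective i>0 j>0 (prime-∣-prime (p-prime i>0) pj-prime (prime-∣-^ a (p-prime i>0) pi∣pj^a)))
        ... | inj₂ pi∣m = A-free i i>0 i≤k (∣-trans pi∣m (n∣m*n (r ^ a)))

    -- On the indices k < i < u, put p u in place of p j: each ratio can only decrease, and the
    -- resulting primes contain every prime factor of A once these are all at most p u.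
    exchanged : ℕ → ℕ
    exchanged i with i ≟ j
    ... | yes _ = p u
    ... | no _  = p i

    exchanged-j : exchanged j ≡ p u
    exchanged-j with j ≟ j
    ... | yes _  = refl
    ... | no j≢j = contradiction refl j≢j

    exchanged-≢ : ∀ {i} → i ≢ j → exchanged i ≡ p i
    exchanged-≢ {i} i≢j with i ≟ j
    ... | yes i≡j = contradiction i≡j i≢j
    ... | no _    = refl

    indices : List ℕ
    indices = range (suc k) (pred u)

    exchanged-prime : ∀ i → i ∈ indices → Prime (exchanged i)
    exchanged-prime i i∈ with i ≟ j
    ... | yes _ = p-prime u>0
    ... | no _  = p-prime (<-≤-trans z<s (proj₁ (∈-range⁻ i∈)))

    exchanged-ratio-≤ : ∀ i → i ∈ indices → exchanged i * ratio-den (p i) ≤ p i * ratio-den (exchanged i)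
    exchanged-ratio-≤ i _ with i ≟ j
    ... | yes refl = ratio-antitone (prime>1 pj-prime) (p-mono j>0 j≤u)
    ... | no _     = ≤-refl

    prime-factors∈exchanged : (∀ r → Prime r → r ∣ A → r ≤ p u) →
                              ∀ r → Prime r → r ∣ A → r ∈ map exchanged indices
    prime-factors∈exchanged bounded r r-prime r∣A
      with i , k<i , i≤u , refl ← prime-factor-index u>0 r-prime r∣A (bounded r r-prime r∣A)
      with i ≟ j | m≤n⇒m<n∨m≡n i≤u
    ... | yes refl | _        = contradiction r∣A pj∤A
    ... | no i≢j   | inj₁ i<u = subst (_∈ map exchanged indices) (exchanged-≢ i≢j)
                                  (∈-map⁺ exchanged (∈-range⁺ k<i (<⇒≤pred i<u)))
    ... | no i≢j   | inj₂ refl = subst (_∈ map exchanged indices) exchanged-j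
                                  (∈-map⁺ exchanged (∈-range⁺ k<j (<⇒≤pred (≤∧≢⇒< j≤u (i≢j ∘ sym)))))

    bounded-prime-factors-⊥ : (∀ r → Prime r → r ∣ A → r ≤ p u) → ⊥
    bounded-prime-factors-⊥ bounded = proj₂ u-least (pred u) (≤-reflexive (suc-pred u {{>-nonZero u>0}}))
      (upward (ratioProduct-mono exchanged p indices exchanged-ratio-≤)
        (upward (σ₋₁-≤-ratioProduct exchanged indices exchanged-prime A A>0 (prime-factors∈exchanged bounded))
          σ₋₁A≥λ))

  p-∣-A : ∀ {j} → k < j → j ≤ u → p j ∣ A
  p-∣-A {j} k<j j≤u = decidable-stable (p j ∣? A) λ pj∤A →
    bounded-prime-factors-⊥ k<j j≤u pj∤A (prime-factors-≤-pu k<j j≤u pj∤A)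

lemma4p13 : (p : ℕ → ℕ) → IsPrimeEnumeration p →
    (Geq : ℚ → Set) → RealAboveOne Geq →
    (k u A : ℕ) → IsU Geq p k u → IsA Geq p k A →
    prodPrimes p k u ∣ A
lemma4p13 p p-enum Geq λ-real k u A u-least A-least =
  subst (_∣ A) (foldr-map _*_ p 1 divisorIndices)
    (product-∣ (All.map⁺ (All.tabulate (p-prime ∘ index>0)))
               (map-p-range-unique k u)
               (All.map⁺ (All.tabulate (λ j∈ → uncurry p-∣-A (∈-range⁻ j∈)))))
  where
  open PrimeEnumeration p p-enum
  open Minimality p p-enum λ-real u-least A-least
  divisorIndices : List ℕ
  divisorIndices = range (suc k) u
  index>0 : ∀ {j} → j ∈ divisorIndices → 0 < j
  index>0 j∈ = <-≤-trans z<s (proj₁ (∈-range⁻ j∈))
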